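{- For every integer $n\ge 4$, all $p,q\in\{n,n+1,n+2\}$, and every positive integer $m$, the $m$-th line digraph $L^m(C_n\cdot C_p\cdot C_q)$ is a DNA graph.
   Context: All digraphs are finite. For an arc $a=uv$, $u$ is its tail and $v$ its head. The line digraph $L(D)$ has vertex set $A(D)$, with an arc $xy$ iff the head of $x$ equals the tail of $y$; $L^1(D)=L(D)$, $L^{m+1}(D)=L(L^m(D))$. For integers $\alpha>0$, $k>1$, an $(\alpha,k)$-labeling of $D=(V,A)$ assigns to each vertex $x$ a string $(l_1(x),\dots,l_k(x))$ with entries in $\{1,\dots,\alpha\}$, distinct vertices getting distinct strings, such that for all vertices $x,y$: $xy\in A$ iff $l_i(x)=l_{i-1}(y)$ for all $i\in\{2,\dots,k\}$. A DNA graph is a digraph admitting a $(4,k)$-labeling for some integer $k>1$. The 3-blade-propeller $C_n\cdot C_p\cdot C_q$ is obtained from three otherwise vertex-disjoint directed cycles of lengths $n$, $p$, $q$ by identifying one vertex from each of them into a single common vertex. -}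

module Defs where

open import Data.Nat using (ℕ; zero; suc; _∸_; _≤_; _+_)
open import Data.Fin using (Fin; zero; suc; inject₁; toℕ)
open import Data.Fin.Properties using () renaming (_≟_ to _≟ᶠ_)
open import Data.Nat.Properties using () renaming (_≟_ to _≟ℕ_)
open import Data.Bool using (Bool; true; false; T; _∧_)
open import Data.Maybe using (Maybe; just; nothing)
open import Data.Product using (Σ; _×_; _,_; proj₁; proj₂)
open import Data.Vec using (Vec; lookup)
open import Relation.Nullary using (does)
open import Relation.Binary.PropositionalEquality using (_≡_)
open import Function using (Injective; _⇔_)

record Digraph : Set₁ where
  field
    Vtx : Set
    adj : Vtx → Vtx → Bool

open Digraph public

Arc : (D : Digraph) → Set
Arc D = Σ (Vtx D × Vtx D) λ uv → T (adj D (proj₁ uv) (proj₂ uv))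

tailA : {D : Digraph} → Arc D → Vtx D
tailA a = proj₁ (proj₁ a)

headA : {D : Digraph} → Arc D → Vtx D
headA a = proj₂ (proj₁ a)

-- Line digraph: vertices are arcs; xy an arc iff head x = tail y.
-- (Vertex equality of D is needed decidably; we require a decider.)
record DecDigraph : Set₁ where
  field
    dg   : Digraph
    _≟v_ : (x y : Vtx dg) → Relation.Nullary.Dec (x ≡ y)

open DecDigraph public

lineDigraph : DecDigraph → DecDigraph
lineDigraph D = record
  { dg = record { Vtx = Arc (dg D)
                ; adj = λ x y → does (_≟v_ D (headA {dg D} x) (tailA {dg D} y)) }
  ; _≟v_ = decArc }
  where
  open import Data.Product.Properties using (≡-dec)
  open import Relation.Nullary using (Dec; yes; no)
  decT : {b : Bool} (s t : T b) → Dec (s ≡ t)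
  decT {true} _ _ = yes Relation.Binary.PropositionalEquality.refl
  decArc : (x y : Arc (dg D)) → Dec (x ≡ y)
  decArc = ≡-dec (≡-dec (_≟v_ D) (_≟v_ D)) decT

-- L^m(D), m ≥ 1 : iterL m D = L^(m+1)(D)
iterL : ℕ → DecDigraph → DecDigraph
iterL zero    D = lineDigraph D
iterL (suc m) D = lineDigraph (iterL m D)

-- (α , k)-labeling, with k = suc (suc j) (so k > 1); the entries are
-- Fin α, i.e. {1,…,α} shifted to {0,…,α-1}. Position i of the paper
-- (1-based) is Fin index i-1; the condition l_i(x) = l_{i-1}(y) for
-- i ∈ {2..k} becomes lookup (l x) (suc i) ≡ lookup (l y) (inject₁ i)
-- for i : Fin (suc j).
record Labeling (α j : ℕ) (D : Digraph) : Set where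
  field
    lab     : Vtx D → Vec (Fin α) (suc (suc j))
    lab-inj : Injective _≡_ _≡_ lab
    lab-arc : ∀ x y → T (adj D x y) ⇔
                ((i : Fin (suc j)) → lookup (lab x) (suc i) ≡ lookup (lab y) (inject₁ i))

IsDNAGraph : Digraph → Set
IsDNAGraph D = Σ ℕ λ j → Labeling 4 j D

-- Vertices: nothing = the common vertex c; just (b , i) = the i-th
-- non-common vertex (i < len b - 1) of blade b ∈ {0,1,2}.
-- Blade b is the cycle c → (b,0) → (b,1) → … → (b,len b - 2) → c.
bladeLen : ℕ → ℕ → ℕ → Fin 3 → ℕ
bladeLen n p q zero = n
bladeLen n p q (suc zero) = p
bladeLen n p q (suc (suc zero)) = q

PVtx : ℕ → ℕ → ℕ → Set
PVtx n p q = Maybe (Σ (Fin 3) λ b → Fin (bladeLen n p q b ∸ 1))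

propAdj : (n p q : ℕ) → PVtx n p q → PVtx n p q → Bool
propAdj n p q nothing nothing = false      -- no loops (all lengths ≥ 2 here)
propAdj n p q nothing (just (b , i)) = does (toℕ i ≟ℕ 0)
propAdj n p q (just (b , i)) nothing = does (suc (toℕ i) ≟ℕ (bladeLen n p q b ∸ 1))
propAdj n p q (just (b , i)) (just (b' , i')) =
  does (b ≟ᶠ b') ∧ does (suc (toℕ i) ≟ℕ toℕ i')

propDecEq : (n p q : ℕ) (x y : PVtx n p q) → Relation.Nullary.Dec (x ≡ y)
propDecEq n p q = Data.Maybe.Properties.≡-dec
  (Data.Product.Properties.≡-dec _≟ᶠ_ λ {b} → _≟ᶠ_)
  where
  import Data.Maybe.Properties
  import Data.Product.Properties

propeller : (n p q : ℕ) → DecDigraph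
propeller n p q = record
  { dg = record { Vtx = PVtx n p q ; adj = propAdj n p q }
  ; _≟v_ = propDecEq n p q }

module Submission where

-- (1) Labelings lift through the line-digraph operator: labelling the arc uv
--     by l₁(u) followed by l(v) turns an (α,k)-labeling l of D into an
--     (α,k+1)-labeling of L(D).  So it suffices to label the propeller.
-- (2) With K = n - 2, blade b is read as the word 0^K 1 t_b 0 0 …, where the
--     tail t_b over {1,2,3} has length |C_b| - n + 1; the hub is offset 0 and
--     the i-th vertex of blade b is offset i+1 of this word.  Each vertex is
--     labelled by the window of length K+1 at its offset.  If the tails form
--     a "tail system" (no blanks, the letter 1 only at the end, distinct first
--     letters, distinct adjacent pairs), then windows agreeing on K letters sit
--     at the same offset and, away from offsets 0 and 1, on the same blade.
--     This window lemma gives injectivity and the arc condition.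
-- (3) For each of the nine pairs (p, q) explicit tails are given; their
--     tail-system conditions are finite and checked by computation.

open import Defs
open import Data.Nat using (ℕ; zero; suc; _+_; _∸_; _≤_; _<_; z≤n; s≤s; _≤?_)
  renaming (_≟_ to _≟ℕ_)
open import Data.Nat.Properties
  using (≤-refl; ≤-trans; <-cmp; +-suc; +-assoc; +-comm; +-identityʳ; +-monoʳ-<;
         +-monoˡ-<; +-monoˡ-≤; +-cancelˡ-≤; m≤m+n; m<n+m; m<n⇒m<1+n; suc-injective;
         ≤∧≢⇒<; ≰⇒>; m≤n⇒∃[o]m+o≡n; allUpTo?)
open import Data.Fin using (Fin; zero; suc; toℕ; inject₁; fromℕ<; cast; #_)
open import Data.Fin.Properties
  using (toℕ<n; toℕ-injective; toℕ-fromℕ<; toℕ-inject₁; toℕ-cast; all?)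
  renaming (_≟_ to _≟ᶠ_)
open import Data.Bool using (true; T)
open import Data.Bool.Properties using (T-∧)
open import Data.Empty using (⊥-elim)
open import Data.List using (List; []; _∷_; length)
open import Data.Maybe using (just; nothing)
open import Data.Product using (Σ; _×_; _,_; proj₁; proj₂)
open import Data.Sum using (_⊎_; inj₁; inj₂)
open import Data.Vec using (Vec; _∷_; lookup; tabulate)
open import Data.Vec.Properties using (tabulate∘lookup; tabulate-cong; lookup∘tabulate)
open import Function using (_⇔_; mk⇔; Injective; Equivalence)
open import Relation.Nullary using (Dec; yes; no; does; ¬_; ¬?)
open import Relation.Nullary.Decidable using (from-yes; _×-dec_; _→-dec_)
open import Relation.Binary.Definitions using (tri<; tri≈; tri>)
open import Relation.Binary.PropositionalEquality
  using (_≡_; _≢_; refl; sym; trans; cong; subst; module ≡-Reasoning)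

decided : {P : Set} (d : Dec P) → T (does d) → P
decided (yes p) _ = p

decide : {P : Set} (d : Dec P) → P → T (does d)
decide (yes _) _ = _
decide (no ¬p) p = ⊥-elim (¬p p)

Agree : {A : Set} → ℕ → (ℕ → A) → (ℕ → A) → Set
Agree n f g = ∀ e → e < n → f e ≡ g e

Agree-sym : {A : Set} {n : ℕ} {f g : ℕ → A} → Agree n f g → Agree n g f
Agree-sym agree e e<n = sym (agree e e<n)

lookup-ext : {A : Set} {n : ℕ} (xs ys : Vec A n) →
             (∀ i → lookup xs i ≡ lookup ys i) → xs ≡ ys
lookup-ext xs ys same =
  trans (sym (tabulate∘lookup xs)) (trans (tabulate-cong same) (tabulate∘lookup ys))

prefix : {A : Set} (n : ℕ) → (ℕ → A) → Vec A n
prefix n f = tabulate (λ i → f (toℕ i))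

lookup-prefix : {A : Set} {n : ℕ} (f : ℕ → A) {e : ℕ} (e<n : e < n) →
                lookup (prefix n f) (fromℕ< e<n) ≡ f e
lookup-prefix f e<n =
  trans (lookup∘tabulate (λ k → f (toℕ k)) (fromℕ< e<n)) (cong f (toℕ-fromℕ< e<n))

prefix-agree : {A : Set} {n : ℕ} (f g : ℕ → A) → prefix n f ≡ prefix n g → Agree n f g
prefix-agree f g eq e e<n =
  trans (sym (lookup-prefix f e<n))
        (trans (cong (λ v → lookup v (fromℕ< e<n)) eq) (lookup-prefix g e<n))

prefix-shift : {A : Set} {n : ℕ} (f g : ℕ → A) →
  ((i : Fin n) → lookup (prefix (suc n) f) (suc i) ≡ lookup (prefix (suc n) g) (inject₁ i))
  ⇔ Agree n (λ e → f (suc e)) g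
prefix-shift {A} {n} f g = mk⇔ to from
  where
  Shifted : Set
  Shifted = (i : Fin n) → lookup (prefix (suc n) f) (suc i) ≡ lookup (prefix (suc n) g) (inject₁ i)

  at-inject : (i : Fin n) → lookup (prefix (suc n) g) (inject₁ i) ≡ g (toℕ i)
  at-inject i = trans (lookup∘tabulate (λ k → g (toℕ k)) (inject₁ i)) (cong g (toℕ-inject₁ i))

  to : Shifted → Agree n (λ e → f (suc e)) g
  to shifted e e<n = begin
    f (suc e)                                        ≡⟨ sym (lookup-prefix (λ x → f (suc x)) e<n) ⟩
    lookup (prefix (suc n) f) (suc (fromℕ< e<n))     ≡⟨ shifted (fromℕ< e<n) ⟩
    lookup (prefix (suc n) g) (inject₁ (fromℕ< e<n)) ≡⟨ at-inject (fromℕ< e<n) ⟩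
    g (toℕ (fromℕ< e<n))                             ≡⟨ cong g (toℕ-fromℕ< e<n) ⟩
    g e                                              ∎
    where open ≡-Reasoning

  from : Agree n (λ e → f (suc e)) g → Shifted
  from agree i = trans (lookup∘tabulate (λ k → f (toℕ k)) (suc i))
                       (trans (agree (toℕ i) (toℕ<n i)) (sym (at-inject i)))

module Lifting {α : ℕ} (D : DecDigraph) {j : ℕ} (L : Labeling α j (dg D)) where
  open Labeling L
  open Equivalence

  G : Digraph
  G = dg D

  -- Two in-neighbours of one vertex whose labels share the first letter coincide:
  -- the rest of both labels is determined by the common out-neighbour.
  same-in-neighbour : ∀ {u u' v} → T (adj G u v) → T (adj G u' v) →
                      lookup (lab u) zero ≡ lookup (lab u') zero → u ≡ u'
  same-in-neighbour {u} {u'} {v} uv u'v first = lab-inj (lookup-ext _ _ same)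
    where
    same : ∀ i → lookup (lab u) i ≡ lookup (lab u') i
    same zero    = first
    same (suc i) = trans (to (lab-arc u v) uv i) (sym (to (lab-arc u' v) u'v i))

  arcLabel : Arc G → Vec (Fin α) (suc (suc (suc j)))
  arcLabel a = lookup (lab (tailA {G} a)) zero ∷ lab (headA {G} a)

  arcLabel-inj : Injective _≡_ _≡_ arcLabel
  arcLabel-inj {(u , v) , uv} {(u' , v') , u'v'} eq
    with lab-inj (cong Data.Vec.tail eq)
  ... | refl with same-in-neighbour uv u'v' (cong Data.Vec.head eq)
  ... | refl = cong (λ arc → (u , v) , arc) (T-unique uv u'v')
    where
    T-unique : ∀ {b} (s t : T b) → s ≡ t
    T-unique {true} _ _ = refl

  arcLabel-arc : ∀ x y → T (adj (dg (lineDigraph D)) x y) ⇔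
    ((i : Fin (suc (suc j))) → lookup (arcLabel x) (suc i) ≡ lookup (arcLabel y) (inject₁ i))
  arcLabel-arc ((u , v) , uv) ((v' , w) , v'w) = mk⇔ to' from'
    where
    to' : T (does (_≟v_ D v v')) → (i : Fin (suc (suc j))) →
          lookup (lab v) i ≡ lookup (arcLabel ((v' , w) , v'w)) (inject₁ i)
    to' joined i with _≟v_ D v v'
    to' joined zero    | yes refl = refl
    to' joined (suc i) | yes refl = to (lab-arc v w) v'w i

    from' : ((i : Fin (suc (suc j))) →
             lookup (lab v) i ≡ lookup (arcLabel ((v' , w) , v'w)) (inject₁ i)) →
            T (does (_≟v_ D v v'))
    from' agree = decide (_≟v_ D v v')
      (same-in-neighbour (from (lab-arc v w) (λ i → agree (suc i))) v'w (agree zero))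

  liftLabeling : Labeling α (suc j) (dg (lineDigraph D))
  liftLabeling = record { lab = arcLabel ; lab-inj = arcLabel-inj ; lab-arc = arcLabel-arc }

iterateLabeling : {α j : ℕ} (D : DecDigraph) (m : ℕ) →
                  Labeling α j (dg D) → Labeling α (suc m + j) (dg (iterL m D))
iterateLabeling D zero    L = Lifting.liftLabeling D L
iterateLabeling D (suc m) L = Lifting.liftLabeling (iterL m D) (iterateLabeling D m L)

blank mark : Fin 4
blank = zero
mark  = suc zero

blank≢mark : blank ≢ mark
blank≢mark ()

letterAt : List (Fin 4) → ℕ → Fin 4
letterAt []       _       = blank
letterAt (x ∷ _)  zero    = x
letterAt (_ ∷ xs) (suc d) = letterAt xs d

letterAt-beyond : ∀ xs {d} → length xs ≤ d → letterAt xs d ≡ blank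
letterAt-beyond []       _         = refl
letterAt-beyond (_ ∷ xs) (s≤s len) = letterAt-beyond xs len

record TailSystem (B : Set) : Set where
  field
    tailOf         : B → List (Fin 4)
    nonempty       : ∀ b → 0 < length (tailOf b)
    nonblank       : ∀ b {d} → d < length (tailOf b) → letterAt (tailOf b) d ≢ blank
    mark-last      : ∀ b {d} → d < length (tailOf b) →
                     letterAt (tailOf b) d ≡ mark → letterAt (tailOf b) (suc d) ≡ blank
    heads-distinct : ∀ b b' → letterAt (tailOf b) 0 ≡ letterAt (tailOf b') 0 → b ≡ b'
    pairs-distinct : ∀ b b' {d} → d < length (tailOf b) → ∀ {d'} → d' < length (tailOf b') →
                     letterAt (tailOf b) d ≡ letterAt (tailOf b') d' →
                     letterAt (tailOf b) (suc d) ≡ letterAt (tailOf b') (suc d') →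
                     b ≡ b' × d ≡ d'

frameWord : ℕ → (ℕ → Fin 4) → ℕ → Fin 4
frameWord zero    t zero    = mark
frameWord zero    t (suc j) = t j
frameWord (suc K) t zero    = blank
frameWord (suc K) t (suc j) = frameWord K t j

frameWord-blank : ∀ K t {j} → j < K → frameWord K t j ≡ blank
frameWord-blank (suc K) t {zero}  _         = refl
frameWord-blank (suc K) t {suc j} (s≤s j<K) = frameWord-blank K t j<K

frameWord-mark : ∀ K t → frameWord K t K ≡ mark
frameWord-mark zero    t = refl
frameWord-mark (suc K) t = frameWord-mark K t

frameWord-tail : ∀ K t d → frameWord K t (K + suc d) ≡ t d
frameWord-tail zero    t d = refl
frameWord-tail (suc K) t d = frameWord-tail K t d

frameWord-frame : ∀ K t t' {j} → j ≤ K → frameWord K t j ≡ frameWord K t' j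
frameWord-frame zero    t t' z≤n       = refl
frameWord-frame (suc K) t t' z≤n       = refl
frameWord-frame (suc K) t t' (s≤s j≤K) = frameWord-frame K t t' j≤K

module Windows {B : Set} (S : TailSystem B) (K : ℕ) (1<K : 1 < K) where
  open TailSystem S

  letter : B → ℕ → Fin 4
  letter b = letterAt (tailOf b)

  len : B → ℕ
  len b = length (tailOf b)

  word : B → ℕ → Fin 4
  word b = frameWord K (letter b)

  win : B → ℕ → ℕ → Fin 4
  win b s e = word b (s + e)

  tail-at : ∀ b d e → word b ((K + suc d) + e) ≡ letter b (e + d)
  tail-at b d e = begin
    word b ((K + suc d) + e) ≡⟨ cong (word b) (+-assoc K (suc d) e) ⟩
    word b (K + suc (d + e)) ≡⟨ frameWord-tail K (letter b) (d + e) ⟩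
    letter b (d + e)         ≡⟨ cong (letter b) (+-comm d e) ⟩
    letter b (e + d)         ∎
    where open ≡-Reasoning

  data Zone (b : B) : ℕ → Set where
    frame : ∀ {s} r → s + r ≡ K → Zone b s
    trail : ∀ d → d < len b → Zone b (K + suc d)

  zone : ∀ b {s} → s ≤ K + len b → Zone b s
  zone b {s} s≤ with s ≤? K
  ... | yes s≤K = let r , eq = m≤n⇒∃[o]m+o≡n s≤K in frame r eq
  ... | no  s≰K with m≤n⇒∃[o]m+o≡n (≰⇒> s≰K)
  ... | d , refl = subst (Zone b) (+-suc K d) (trail d (+-cancelˡ-≤ K (suc d) (len b) s≤'))
    where
    s≤' : K + suc d ≤ K + len b
    s≤' = subst (_≤ K + len b) (sym (+-suc K d)) s≤

  0<K : 0 < K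
  0<K = ≤-trans (s≤s z≤n) 1<K

  word-blank : ∀ b {j} → j < K → word b j ≡ blank
  word-blank b = frameWord-blank K (letter b)

  frame-mark : ∀ b {s r} → s + r ≡ K → word b (s + r) ≡ mark
  frame-mark b eq = trans (cong (word b) eq) (frameWord-mark K (letter b))

  frame-head : ∀ b {s r} → s + r ≡ K → word b (s + suc r) ≡ letter b 0
  frame-head b {s} {r} eq = begin
    word b (s + suc r) ≡⟨ cong (word b) (trans (+-suc s r) (cong suc eq)) ⟩
    word b (suc K)     ≡⟨ cong (word b) (+-comm 1 K) ⟩
    word b (K + 1)     ≡⟨ frameWord-tail K (letter b) 0 ⟩
    letter b 0         ∎
    where open ≡-Reasoning

  -- Two frame windows at different offsets disagree at the mark of the later one.
  frame-before-frame : ∀ {b b' s s' r'} → s < s' → s' + r' ≡ K →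
                       ¬ Agree K (win b s) (win b' s')
  frame-before-frame {b} {b'} {s} {s'} {r'} s<s' eq agree =
    blank≢mark (trans (sym (word-blank b (subst (s + r' <_) eq (+-monoˡ-< r' s<s'))))
               (trans (agree r' r'<K) (frame-mark b' {s'} {r'} eq)))
    where
    r'<K : r' < K
    r'<K = subst (r' <_) eq (m<n+m r' {s'} (≤-trans (s≤s z≤n) s<s'))

  -- Two frame windows at the same offset s ≥ 2 disagree at the first tail
  -- letter unless they come from the same blade.
  frame-same-offset : ∀ {b b'} s {r} → s + r ≡ K → Agree K (win b s) (win b' s) →
                      s ≡ 0 ⊎ s ≡ 1 ⊎ b ≡ b'
  frame-same-offset zero                _ _ = inj₁ refl
  frame-same-offset (suc zero)          _ _ = inj₂ (inj₁ refl)
  frame-same-offset {b} {b'} s@(suc (suc _)) {r} eq agree =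
    inj₂ (inj₂ (heads-distinct b b'
      (trans (sym (frame-head b {s} {r} eq)) (trans (agree (suc r) r+1<K) (frame-head b' {s} {r} eq)))))
    where
    r+1<K : suc r < K
    r+1<K = subst (suc r <_) eq (+-monoˡ-≤ r {2} {s} (s≤s (s≤s z≤n)))

  -- The tail window starts
  -- with a non-blank letter, so the frame window must start with the mark
  -- (r = 0); then the tail window continues with a blank while the frame
  -- window continues with the first letter of its tail.
  frame-before-trail : ∀ {b b' s r d'} → s + r ≡ K → d' < len b' →
                       ¬ Agree K (win b s) (win b' (K + suc d'))
  frame-before-trail {b} {b'} {s} {suc r} {d'} eq d'<len agree =
    nonblank b' d'<len (trans (sym (tail-at b' d' 0)) (trans (sym (agree 0 0<K)) starts-blank))
    where
    starts-blank : word b (s + 0) ≡ blank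
    starts-blank = word-blank b (subst (s + 0 <_) eq (+-monoʳ-< s (s≤s z≤n)))
  frame-before-trail {b} {b'} {s} {zero} {d'} eq d'<len agree =
    nonblank b (nonempty b) (begin
      letter b 0                 ≡⟨ sym (frame-head b {s} {0} eq) ⟩
      word b (s + 1)             ≡⟨ agree 1 1<K ⟩
      word b' ((K + suc d') + 1) ≡⟨ tail-at b' d' 1 ⟩
      letter b' (suc d')         ≡⟨ mark-last b' d'<len starts-with-mark ⟩
      blank                      ∎)
    where
    open ≡-Reasoning
    starts-with-mark : letter b' d' ≡ mark
    starts-with-mark =
      trans (sym (tail-at b' d' 0)) (trans (sym (agree 0 0<K)) (frame-mark b {s} {0} eq))

  -- Two tail windows agreeing on their first two letters are the same.
  trail-trail : ∀ {b b' d d'} → d < len b → d' < len b' →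
                Agree K (win b (K + suc d)) (win b' (K + suc d')) → b ≡ b' × d ≡ d'
  trail-trail {b} {b'} {d} {d'} d<len d'<len agree =
    pairs-distinct b b' d<len d'<len (letters-agree 0 0<K)
                                     (letters-agree 1 1<K)
    where
    letters-agree : ∀ e → e < K → letter b (e + d) ≡ letter b' (e + d')
    letters-agree e e<K = trans (sym (tail-at b d e)) (trans (agree e e<K) (tail-at b' d' e))

  window-prefix : ∀ {b b' s s'} → s ≤ K + len b → s' ≤ K + len b' →
                  Agree K (win b s) (win b' s') → s ≡ s' × (s ≡ 0 ⊎ s ≡ 1 ⊎ b ≡ b')
  window-prefix {b} {b'} s≤ s'≤ agree = compare (zone b s≤) (zone b' s'≤) agree
    where
    compare : ∀ {s s'} → Zone b s → Zone b' s' → Agree K (win b s) (win b' s') →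
              s ≡ s' × (s ≡ 0 ⊎ s ≡ 1 ⊎ b ≡ b')
    compare {s} {s'} (frame r eq) (frame r' eq') agree with <-cmp s s'
    ... | tri< s<s' _ _ = ⊥-elim (frame-before-frame s<s' eq' agree)
    ... | tri> _ _ s'<s = ⊥-elim (frame-before-frame s'<s eq (Agree-sym agree))
    ... | tri≈ _ refl _ = refl , frame-same-offset s eq agree
    compare (frame r eq) (trail d' d'<len) agree = ⊥-elim (frame-before-trail eq d'<len agree)
    compare (trail d d<len) (frame r' eq') agree =
      ⊥-elim (frame-before-trail eq' d<len (Agree-sym agree))
    compare (trail d d<len) (trail d' d'<len) agree with trail-trail d<len d'<len agree
    ... | refl , refl = refl , inj₂ (inj₂ refl)

  -- With one more letter the blade is determined also at offset 1, by the
  -- first letter of its tail.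
  window-full : ∀ {b b' s s'} → s ≤ K + len b → s' ≤ K + len b' →
                Agree (suc K) (win b s) (win b' s') → s ≡ s' × (s ≡ 0 ⊎ b ≡ b')
  window-full {b} {b'} s≤ s'≤ agree
    with window-prefix s≤ s'≤ (λ e e<K → agree e (m<n⇒m<1+n e<K))
  ... | refl , inj₁ s≡0        = refl , inj₁ s≡0
  ... | refl , inj₂ (inj₂ b≡b') = refl , inj₂ b≡b'
  ... | refl , inj₂ (inj₁ refl) =
    refl , inj₂ (heads-distinct b b'
      (trans (sym (frame-head b {0} {K} refl)) (trans (agree K ≤-refl) (frame-head b' {0} {K} refl))))

module PropellerLabeling (n p q k : ℕ) (0<k : 0 < k) (S : TailSystem (Fin 3))
  (blade-sizes : ∀ b → bladeLen n p q b ∸ 1 ≡ suc k + length (TailSystem.tailOf S b))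
  where
  open TailSystem S
  open Windows S (suc k) (s≤s 0<k)

  K : ℕ
  K = suc k

  V : Set
  V = PVtx n p q

  arc : V → V → Set
  arc x y = T (propAdj n p q x y)

  blade : V → Fin 3
  blade nothing        = zero
  blade (just (b , _)) = b

  offset : V → ℕ
  offset nothing        = 0
  offset (just (_ , i)) = suc (toℕ i)

  offset-range : ∀ x → offset x ≤ K + len (blade x)
  offset-range nothing        = z≤n
  offset-range (just (b , i)) = subst (suc (toℕ i) ≤_) (blade-sizes b) (toℕ<n i)

  window : V → ℕ → Fin 4
  window x = win (blade x) (offset x)

  vertex-ext : ∀ x y → offset x ≡ offset y → offset x ≡ 0 ⊎ blade x ≡ blade y → x ≡ y
  vertex-ext nothing        nothing         _  _          = refl
  vertex-ext nothing        (just _)        () _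
  vertex-ext (just _)       nothing         () _
  vertex-ext (just _)       (just _)        _  (inj₁ ())
  vertex-ext (just (b , i)) (just (b , i')) eq (inj₂ refl) =
    cong (λ j → just (b , j)) (toℕ-injective (suc-injective eq))

  prefix-classify : ∀ y y' → Agree K (window y) (window y') →
                    y ≡ y' ⊎ (offset y ≡ 1 × offset y' ≡ 1)
  prefix-classify y y' agree with window-prefix (offset-range y) (offset-range y') agree
  ... | same , inj₁ at-hub     = inj₁ (vertex-ext y y' same (inj₁ at-hub))
  ... | same , inj₂ (inj₁ one) = inj₂ (one , trans (sym same) one)
  ... | same , inj₂ (inj₂ b≡b') = inj₁ (vertex-ext y y' same (inj₂ b≡b'))

  window-injective : ∀ x y → Agree (suc K) (window x) (window y) → x ≡ y
  window-injective x y agree with window-full (offset-range x) (offset-range y) agree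
  ... | same , hub-or-blade = vertex-ext x y same hub-or-blade

  first : Fin 3 → V
  first b = just (b , cast (sym (blade-sizes b)) zero)

  first-offset : ∀ b → offset (first b) ≡ 1
  first-offset b = cong suc (toℕ-cast (sym (blade-sizes b)) zero)

  -- Along an arc, the window moves one letter forward: from the hub into a
  -- blade both windows lie in the frame, which is the same for all blades;
  -- from the last vertex of a blade to the hub both windows are blank.
  arc-shift : ∀ x y → arc x y → Agree K (λ e → window x (suc e)) (window y)
  arc-shift nothing nothing ()
  arc-shift nothing (just (b , i)) hub→i e e<K
    rewrite decided (toℕ i ≟ℕ 0) hub→i = frameWord-frame K (letter zero) (letter b) e<K
  arc-shift (just (b , i)) nothing last→hub e e<K = begin
    word b (suc (toℕ i) + suc e)      ≡⟨ cong (λ o → word b (o + suc e)) (trans last (blade-sizes b)) ⟩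
    word b ((K + len b) + suc e)      ≡⟨ cong (word b) (trans (+-assoc K (len b) (suc e))
                                                              (cong (K +_) (+-suc (len b) e))) ⟩
    word b (K + suc (len b + e))      ≡⟨ frameWord-tail K (letter b) (len b + e) ⟩
    letter b (len b + e)              ≡⟨ letterAt-beyond (tailOf b) (m≤m+n (len b) e) ⟩
    blank                             ≡⟨ sym (word-blank zero e<K) ⟩
    word zero e                       ∎
    where
    open ≡-Reasoning
    last : suc (toℕ i) ≡ bladeLen n p q b ∸ 1
    last = decided (suc (toℕ i) ≟ℕ (bladeLen n p q b ∸ 1)) last→hub
  arc-shift (just (b , i)) (just (b' , i')) i→i' e e<K
    with decided (b ≟ᶠ b') (proj₁ (Equivalence.to T-∧ i→i'))
  ... | refl = cong (word b) (trans (+-suc (suc (toℕ i)) e) (cong (λ o → suc o + e) next))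
    where
    next : suc (toℕ i) ≡ toℕ i'
    next = decided (suc (toℕ i) ≟ℕ toℕ i') (proj₂ (Equivalence.to T-∧ i→i'))

  successor : ∀ x → Σ V (arc x)
  successor nothing        = first zero , decide (_ ≟ℕ 0) (suc-injective (first-offset zero))
  successor (just (b , i)) with suc (toℕ i) ≟ℕ (bladeLen n p q b ∸ 1)
  ... | yes last = nothing , decide (suc (toℕ i) ≟ℕ _) last
  ... | no ¬last = just (b , fromℕ< i+1<) ,
                   Equivalence.from T-∧ (decide (b ≟ᶠ b) refl ,
                                         decide (suc (toℕ i) ≟ℕ _) (sym (toℕ-fromℕ< i+1<)))
    where
    i+1< : suc (toℕ i) < bladeLen n p q b ∸ 1
    i+1< = ≤∧≢⇒< (toℕ<n i) ¬last

  into-first : ∀ x y → arc x y → offset y ≡ 1 → x ≡ nothing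
  into-first nothing        _               _    _   = refl
  into-first (just _)       nothing         _    ()
  into-first (just (b , i)) (just (b' , i')) i→i' one
    with trans (decided (suc (toℕ i) ≟ℕ toℕ i') (proj₂ (Equivalence.to T-∧ i→i'))) (suc-injective one)
  ... | ()

  hub-to-first : ∀ y → offset y ≡ 1 → arc nothing y
  hub-to-first (just (b , i)) one = decide (toℕ i ≟ℕ 0) (suc-injective one)

  -- Conversely, a forward-moving window determines an arc: compare y with an
  -- actual successor y' of x by the window lemma.
  shift-arc : ∀ x y → Agree K (λ e → window x (suc e)) (window y) → arc x y
  shift-arc x y shifted with successor x
  ... | y' , x→y'
    with prefix-classify y y' (λ e e<K → trans (sym (shifted e e<K)) (arc-shift x y' x→y' e e<K))
  ... | inj₁ refl = x→y'
  ... | inj₂ (y-first , y'-first) with into-first x y' x→y' y'-first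
  ... | refl = hub-to-first y y-first

  labeling : Labeling 4 k (dg (propeller n p q))
  labeling = record
    { lab     = λ x → prefix (suc K) (window x)
    ; lab-inj = λ {x} {y} eq → window-injective x y (prefix-agree (window x) (window y) eq)
    ; lab-arc = λ x y → mk⇔
        (λ x→y → Equivalence.from (prefix-shift (window x) (window y)) (arc-shift x y x→y))
        (λ shifted → shift-arc x y (Equivalence.to (prefix-shift (window x) (window y)) shifted))
    }

excess : Fin 3 → Fin 3 → Fin 3 → ℕ
excess a c zero             = 0
excess a c (suc zero)       = toℕ a
excess a c (suc (suc zero)) = toℕ c

-- Explicit tails over {1,2,3}, of length excess + 1: blade 0 gets 1, blade 1
-- a word starting with 2 and blade 2 one starting with 3.  When p = n + 2
-- the two words are chosen jointly so that adjacent letter pairs differ.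
tail₁ : Fin 3 → Fin 3 → List (Fin 4)
tail₁ zero             _       = # 2 ∷ []
tail₁ (suc zero)       _       = # 2 ∷ # 2 ∷ []
tail₁ (suc (suc zero)) zero    = # 2 ∷ # 3 ∷ # 2 ∷ []
tail₁ (suc (suc zero)) (suc _) = # 2 ∷ # 2 ∷ # 3 ∷ []

tail₂ : Fin 3 → Fin 3 → List (Fin 4)
tail₂ _                zero             = # 3 ∷ []
tail₂ (suc (suc zero)) (suc zero)       = # 3 ∷ # 2 ∷ []
tail₂ _                (suc zero)       = # 3 ∷ # 3 ∷ []
tail₂ (suc (suc zero)) (suc (suc zero)) = # 3 ∷ # 3 ∷ # 2 ∷ []
tail₂ _                (suc (suc zero)) = # 3 ∷ # 2 ∷ # 3 ∷ []

tails : Fin 3 → Fin 3 → Fin 3 → List (Fin 4)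
tails a c zero             = mark ∷ []
tails a c (suc zero)       = tail₁ a c
tails a c (suc (suc zero)) = tail₂ a c

tails-length : ∀ a c b → length (tails a c b) ≡ suc (excess a c b)
tails-length = from-yes (all? λ a → all? λ c → all? λ b →
  length (tails a c b) ≟ℕ suc (excess a c b))

tails-nonblank : ∀ a c b {d} → d < length (tails a c b) → letterAt (tails a c b) d ≢ blank
tails-nonblank = from-yes (all? λ a → all? λ c → all? λ b →
  allUpTo? (λ d → ¬? (letterAt (tails a c b) d ≟ᶠ blank)) (length (tails a c b)))

tails-mark-last : ∀ a c b {d} → d < length (tails a c b) →
  letterAt (tails a c b) d ≡ mark → letterAt (tails a c b) (suc d) ≡ blank
tails-mark-last = from-yes (all? λ a → all? λ c → all? λ b →
  allUpTo? (λ d → (letterAt (tails a c b) d ≟ᶠ mark) →-dec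
                  (letterAt (tails a c b) (suc d) ≟ᶠ blank))
           (length (tails a c b)))

tails-heads : ∀ a c b b' → letterAt (tails a c b) 0 ≡ letterAt (tails a c b') 0 → b ≡ b'
tails-heads = from-yes (all? λ a → all? λ c → all? λ b → all? λ b' →
  (letterAt (tails a c b) 0 ≟ᶠ letterAt (tails a c b') 0) →-dec (b ≟ᶠ b'))

tails-pairs : ∀ a c b b' {d} → d < length (tails a c b) → ∀ {d'} → d' < length (tails a c b') →
  letterAt (tails a c b) d ≡ letterAt (tails a c b') d' →
  letterAt (tails a c b) (suc d) ≡ letterAt (tails a c b') (suc d') → b ≡ b' × d ≡ d'
tails-pairs = from-yes (all? λ a → all? λ c → all? λ b → all? λ b' →
  allUpTo? (λ d → allUpTo? (λ d' →
    (letterAt (tails a c b) d ≟ᶠ letterAt (tails a c b') d') →-dec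
    ((letterAt (tails a c b) (suc d) ≟ᶠ letterAt (tails a c b') (suc d')) →-dec
     ((b ≟ᶠ b') ×-dec (d ≟ℕ d'))))
    (length (tails a c b'))) (length (tails a c b)))

tailSystem : Fin 3 → Fin 3 → TailSystem (Fin 3)
tailSystem a c = record
  { tailOf         = tails a c
  ; nonempty       = λ b → subst (0 <_) (sym (tails-length a c b)) (s≤s z≤n)
  ; nonblank       = tails-nonblank a c
  ; mark-last      = tails-mark-last a c
  ; heads-distinct = tails-heads a c
  ; pairs-distinct = tails-pairs a c
  }

excess-of : ∀ {n p} → p ≡ n ⊎ p ≡ n + 1 ⊎ p ≡ n + 2 → Σ (Fin 3) λ a → p ≡ n + toℕ a
excess-of {n} (inj₁ p≡n)      = zero , trans p≡n (sym (+-identityʳ n))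
excess-of (inj₂ (inj₁ p≡n+1)) = suc zero , p≡n+1
excess-of (inj₂ (inj₂ p≡n+2)) = suc (suc zero) , p≡n+2

propeller-sizes : ∀ k a c b →
  bladeLen (3 + k) (3 + k + toℕ a) (3 + k + toℕ c) b ∸ 1 ≡ suc k + length (tails a c b)
propeller-sizes k a c b = begin
  bladeLen (3 + k) (3 + k + toℕ a) (3 + k + toℕ c) b ∸ 1 ≡⟨ cong (_∸ 1) (blade-excess b) ⟩
  suc (suc k) + excess a c b                             ≡⟨ sym (+-suc (suc k) (excess a c b)) ⟩
  suc k + suc (excess a c b)                             ≡⟨ cong (suc k +_) (sym (tails-length a c b)) ⟩
  suc k + length (tails a c b)                           ∎
  where
  open ≡-Reasoning
  blade-excess : ∀ b → bladeLen (3 + k) (3 + k + toℕ a) (3 + k + toℕ c) b ≡ 3 + k + excess a c b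
  blade-excess zero             = sym (+-identityʳ (3 + k))
  blade-excess (suc zero)       = refl
  blade-excess (suc (suc zero)) = refl

theorem10 : (n p q : ℕ) → 4 ≤ n →
    (p ≡ n ⊎ p ≡ n + 1 ⊎ p ≡ n + 2) →
    (q ≡ n ⊎ q ≡ n + 1 ⊎ q ≡ n + 2) →
    (m : ℕ) → IsDNAGraph (dg (iterL m (propeller n p q)))
theorem10 .(3 + k) p q (s≤s (s≤s (s≤s {n = k} 0<k))) p-range q-range m
  with excess-of p-range | excess-of q-range
... | a , refl | c , refl =
  _ , iterateLabeling (propeller _ _ _) m
        (PropellerLabeling.labeling _ _ _ k 0<k (tailSystem a c) (propeller-sizes k a c))
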